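{- Let $K = \{A = (a_{ij})\in\mathrm{GL}_3(\mathbb{Z}_2)\mid a_{21} \equiv a_{31} \equiv 0 \bmod 128\}$. Then \[ K\begin{pmatrix}0&1&0\\-128&0&0\\0&0&1\end{pmatrix}K = \coprod_{i=0}^{127}\begin{pmatrix}0&1&0\\-128&0&i\\0&0&1\end{pmatrix}K \ \amalg\ \coprod_{i=0}^{63}\begin{pmatrix}0&1&0\\0&0&1\\-128&0&2i\end{pmatrix}K . \] -}

module Defs where

open import Data.Nat as ℕ using (ℕ; suc)
open import Data.Integer as ℤ using (ℤ; +_; _+_; _*_; -_; _-_)
open import Data.Fin using (Fin; zero; suc; toℕ)
open import Data.Vec using (Vec; []; _∷_; lookup)
open import Data.Product using (Σ; _×_; _,_)
open import Data.Sum using (_⊎_; inj₁; inj₂)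
open import Relation.Binary.PropositionalEquality
open import Data.Integer.Solver using (module +-*-Solver)
open +-*-Solver

-- The 2-adic integers ℤ₂ = lim ℤ/2ⁿℤ, realised as coherent sequences
-- (xₙ) of integers with xₙ₊₁ ≡ xₙ (mod 2ⁿ), up to the equivalence
-- x ≈ y  iff  xₙ ≡ yₙ (mod 2ⁿ) for all n.

pow2 : ℕ → ℤ
pow2 n = + (2 ℕ.^ n)

_∣ℤ_ : ℤ → ℤ → Set
m ∣ℤ z = Σ ℤ λ c → z ≡ c * m

record ℤ₂ : Set where
  constructor mkℤ₂
  field
    seq : ℕ → ℤ
    coh : ∀ n → pow2 n ∣ℤ (seq (suc n) - seq n)
open ℤ₂ public

infix 4 _≈₂_
_≈₂_ : ℤ₂ → ℤ₂ → Set
x ≈₂ y = ∀ n → pow2 n ∣ℤ (seq x n - seq y n)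

ι : ℤ → ℤ₂
ι z = mkℤ₂ (λ _ → z) (λ n → + 0 , solve 2 (λ z p → z :- z := con (+ 0) :* p) refl z (pow2 n))

infixl 6 _+₂_
_+₂_ : ℤ₂ → ℤ₂ → ℤ₂
x +₂ y = mkℤ₂ (λ n → seq x n + seq y n) c
  where
  c : ∀ n → pow2 n ∣ℤ ((seq x (suc n) + seq y (suc n)) - (seq x n + seq y n))
  c n with coh x n | coh y n
  ... | a , ea | b , eb = a + b , (begin
      (seq x (suc n) + seq y (suc n)) - (seq x n + seq y n)
        ≡⟨ solve 4 (λ x' y' x y → (x' :+ y') :- (x :+ y) := (x' :- x) :+ (y' :- y)) refl
                   (seq x (suc n)) (seq y (suc n)) (seq x n) (seq y n) ⟩
      (seq x (suc n) - seq x n) + (seq y (suc n) - seq y n)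
        ≡⟨ cong₂ _+_ ea eb ⟩
      a * pow2 n + b * pow2 n
        ≡⟨ solve 3 (λ a b p → a :* p :+ b :* p := (a :+ b) :* p) refl a b (pow2 n) ⟩
      (a + b) * pow2 n ∎)
    where open ≡-Reasoning

-₂_ : ℤ₂ → ℤ₂
-₂ x = mkℤ₂ (λ n → - seq x n) c
  where
  c : ∀ n → pow2 n ∣ℤ ((- seq x (suc n)) - (- seq x n))
  c n with coh x n
  ... | a , ea = - a , (begin
      (- seq x (suc n)) - (- seq x n)
        ≡⟨ solve 2 (λ x' x → (:- x') :- (:- x) := :- (x' :- x)) refl (seq x (suc n)) (seq x n) ⟩
      - (seq x (suc n) - seq x n)
        ≡⟨ cong -_ ea ⟩
      - (a * pow2 n)
        ≡⟨ solve 2 (λ a p → :- (a :* p) := (:- a) :* p) refl a (pow2 n) ⟩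
      (- a) * pow2 n ∎)
    where open ≡-Reasoning

infixl 7 _*₂_
_*₂_ : ℤ₂ → ℤ₂ → ℤ₂
x *₂ y = mkℤ₂ (λ n → seq x n * seq y n) c
  where
  c : ∀ n → pow2 n ∣ℤ ((seq x (suc n) * seq y (suc n)) - (seq x n * seq y n))
  c n with coh x n | coh y n
  ... | a , ea | b , eb = seq x (suc n) * b + a * seq y n , (begin
      seq x (suc n) * seq y (suc n) - seq x n * seq y n
        ≡⟨ solve 4 (λ x' y' x y → x' :* y' :- x :* y := x' :* (y' :- y) :+ (x' :- x) :* y) refl
                   (seq x (suc n)) (seq y (suc n)) (seq x n) (seq y n) ⟩
      seq x (suc n) * (seq y (suc n) - seq y n) + (seq x (suc n) - seq x n) * seq y n
        ≡⟨ cong₂ (λ u v → seq x (suc n) * u + v * seq y n) eb ea ⟩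
      seq x (suc n) * (b * pow2 n) + (a * pow2 n) * seq y n
        ≡⟨ solve 5 (λ x' a b y p → x' :* (b :* p) :+ (a :* p) :* y
                                 := (x' :* b :+ a :* y) :* p) refl
                   (seq x (suc n)) a b (seq y n) (pow2 n) ⟩
      (seq x (suc n) * b + a * seq y n) * pow2 n ∎)
    where open ≡-Reasoning

_∣₂_ : ℤ₂ → ℤ₂ → Set
m ∣₂ a = Σ ℤ₂ λ c → a ≈₂ c *₂ m

Mat : Set
Mat = Fin 3 → Fin 3 → ℤ₂

infix 4 _≈M_
_≈M_ : Mat → Mat → Set
A ≈M B = ∀ i j → A i j ≈₂ B i j

infixl 7 _·M_
_·M_ : Mat → Mat → Mat
(A ·M B) i j = A i zero *₂ B zero j +₂ A i (suc zero) *₂ B (suc zero) j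
               +₂ A i (suc (suc zero)) *₂ B (suc (suc zero)) j

I₃ : Mat
I₃ zero zero = ι (+ 1)
I₃ (suc zero) (suc zero) = ι (+ 1)
I₃ (suc (suc zero)) (suc (suc zero)) = ι (+ 1)
I₃ _ _ = ι (+ 0)

IsGL₃ : Mat → Set
IsGL₃ A = Σ Mat λ B → (A ·M B ≈M I₃) × (B ·M A ≈M I₃)

fromRows : Vec (Vec ℤ 3) 3 → Mat
fromRows r i j = ι (lookup (lookup r i) j)

-- The group K and the relevant (double) cosets.
-- Indices: a₂₁ is entry (suc zero , zero), a₃₁ is entry (suc (suc zero) , zero).

InK : Mat → Set
InK A = IsGL₃ A × (ι (+ 128) ∣₂ A (suc zero) zero) × (ι (+ 128) ∣₂ A (suc (suc zero)) zero)

γ : Mat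
γ = fromRows ((+ 0 ∷ + 1 ∷ + 0 ∷ []) ∷ (ℤ.-[1+ 127 ] ∷ + 0 ∷ + 0 ∷ []) ∷ (+ 0 ∷ + 0 ∷ + 1 ∷ []) ∷ [])

InKγK : Mat → Set
InKγK g = Σ Mat λ k₁ → Σ Mat λ k₂ → InK k₁ × InK k₂ × (g ≈M k₁ ·M γ ·M k₂)

InCoset : Mat → Mat → Set
InCoset h g = Σ Mat λ k → InK k × (g ≈M h ·M k)

Idx : Set
Idx = Fin 128 ⊎ Fin 64

rep : Idx → Mat
rep (inj₁ i) = fromRows ((+ 0 ∷ + 1 ∷ + 0 ∷ []) ∷ (ℤ.-[1+ 127 ] ∷ + 0 ∷ + toℕ i ∷ []) ∷ (+ 0 ∷ + 0 ∷ + 1 ∷ []) ∷ [])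
rep (inj₂ i) = fromRows ((+ 0 ∷ + 1 ∷ + 0 ∷ []) ∷ (+ 0 ∷ + 0 ∷ + 1 ∷ []) ∷ (ℤ.-[1+ 127 ] ∷ + 0 ∷ + (2 ℕ.* toℕ i) ∷ []) ∷ [])

{-# OPTIONS --safe #-}
module Submission where

-- Everything is decided at level 7, i.e. modulo 128. Left multiplication by rep j turns the
-- rows H₀, H₁, H₂ of a matrix into H₁, slope j · H₂ − 128 · H₀ and H₂ (the last two in the
-- opposite order for the second family). Hence on the coset rep j K one row is congruent to
-- slope j times another one, and the latter is the last row of an element of K, which has an
-- odd entry. Odd numbers are units modulo 128, so slope j is determined by the coset, and an
-- even slope 2i cannot produce the odd row of the first family: the cosets are disjoint.
-- Conversely, for A ∈ K not both of a₁₂, a₂₂ (indices from 0) are even, which yields a slope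
-- j relating rows of A γ; dividing the defect of that relation by 128 in ℤ₂ gives m with
-- rep j · m = A γ, and m ∈ K because cancelling 128 = det γ leaves det m = ± det A. Finally
-- rep j = κ j · γ with κ j ∈ K, so every coset lies in K γ K.

open import Defs
open import Algebra.Bundles.Raw using (RawRing)
open import Data.Empty using (⊥-elim)
open import Data.Fin using (Fin; toℕ; fromℕ<; combine; remQuot; _↑ˡ_; _↑ʳ_)
import Data.Fin.Properties as Fin
open import Data.Fin.Patterns using (0F; 1F; 2F)
open import Data.Integer using (ℤ; +_; -[1+_])
open import Data.Integer.Base using (+-*-rawRing)
open import Data.Integer.DivMod using (n%ℕd<d; a≡a%ℕn+[a/ℕn]*n)
open import Data.Integer.Divisibility.Signed
  using (_∣_; divides; ∣m∣n⇒∣m+n; ∣n⇒∣m*n; ∣m⇒∣-m; ∣-trans; *-monoˡ-∣)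
import Data.Integer.Properties as ℤ
open import Data.Integer.Solver using (module +-*-Solver)
open import Data.Integer.Tactic.RingSolver using (solve-∀)
open import Data.Nat as ℕ using (ℕ; zero; suc; s≤s)
open import Data.Nat.DivMod using (m<n⇒m%n≡m; [m+kn]%n≡m%n)
import Data.Nat.Properties as ℕ
open import Data.Product using (Σ; _×_; _,_; proj₁; proj₂; uncurry)
open import Data.Sum using (_⊎_; inj₁; inj₂)
open import Data.Vec using (Vec; tabulate; _++_; []; _∷_)
open import Relation.Binary.Bundles using (Setoid)
open import Relation.Binary.PropositionalEquality
  using (_≡_; refl; sym; trans; cong; cong₂; subst; subst₂; module ≡-Reasoning)
import Relation.Binary.Reasoning.Setoid as SetoidReasoning
open import Relation.Binary.Structures using (IsEquivalence)
open import Relation.Nullary using (¬_)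

∀-Fin3 : ∀ {ℓ} {P : Fin 3 → Set ℓ} → P 0F → P 1F → P 2F → ∀ i → P i
∀-Fin3 p₀ p₁ p₂ 0F = p₀
∀-Fin3 p₀ p₁ p₂ 1F = p₁
∀-Fin3 p₀ p₁ p₂ 2F = p₂

module Matrix₃ {c ℓ} (R : RawRing c ℓ) where
  open RawRing R

  Matrix : Set c
  Matrix = Fin 3 → Fin 3 → Carrier

  infixl 7 _·_ _⋆_

  _·_ : Matrix → Matrix → Matrix
  (A · B) i j = A i 0F * B 0F j + A i 1F * B 1F j + A i 2F * B 2F j

  _⋆_ : Carrier → Matrix → Matrix
  (x ⋆ A) i j = x * A i j

  𝟙 : Matrix
  𝟙 0F 0F = 1#
  𝟙 1F 1F = 1#
  𝟙 2F 2F = 1#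
  𝟙 _  _  = 0#

  private
    next : Fin 3 → Fin 3
    next 0F = 1F
    next 1F = 2F
    next 2F = 0F

  -- The cyclic rule for cofactors, which needs no signs for 3 × 3 matrices.
  adj : Matrix → Matrix
  adj A i j = A (next j) (next i) * A (next (next j)) (next (next i))
            + - (A (next j) (next (next i)) * A (next (next j)) (next i))

  det : Matrix → Carrier
  det A = A 0F 0F * adj A 0F 0F + A 0F 1F * adj A 1F 0F + A 0F 2F * adj A 2F 0F

-- Opened only here: the fields of RawRing above have the same names.
open import Data.Integer using (_+_; _*_; -_; _-_; _%ℕ_; _/ℕ_; NonZero)

-- Congruences of integers

infix 4 _≡_[mod_]
record _≡_[mod_] (x y m : ℤ) : Set where
  constructor mod-intro
  field ∣-difference : m ∣ x - y
open _≡_[mod_] public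

private
  difference-∣ : ∀ {m x y} z → x - y ≡ z → m ∣ z → x ≡ y [mod m ]
  difference-∣ _ refl = mod-intro

module _ {m : ℤ} where

  ≡⇒≡[mod] : ∀ {x y} → x ≡ y → x ≡ y [mod m ]
  ≡⇒≡[mod] {x} refl = mod-intro (divides (+ 0) (trans (ℤ.+-inverseʳ x) (sym (ℤ.*-zeroˡ m))))

  ≡[mod]-refl : ∀ {x} → x ≡ x [mod m ]
  ≡[mod]-refl = ≡⇒≡[mod] refl

  ≡[mod]-sym : ∀ {x y} → x ≡ y [mod m ] → y ≡ x [mod m ]
  ≡[mod]-sym {x} {y} x≡y = difference-∣ _ (lemma x y) (∣m⇒∣-m (∣-difference x≡y))
    where lemma : ∀ x y → y - x ≡ - (x - y)
          lemma = solve-∀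

  ≡[mod]-trans : ∀ {x y z} → x ≡ y [mod m ] → y ≡ z [mod m ] → x ≡ z [mod m ]
  ≡[mod]-trans {x} {y} {z} x≡y y≡z = difference-∣ _ (sym (ℤ.+-minus-telescope x y z))
    (∣m∣n⇒∣m+n (∣-difference x≡y) (∣-difference y≡z))

  +-cong-mod : ∀ {x y u v} → x ≡ y [mod m ] → u ≡ v [mod m ] → x + u ≡ y + v [mod m ]
  +-cong-mod {x} {y} {u} {v} x≡y u≡v = difference-∣ _ (lemma x y u v)
    (∣m∣n⇒∣m+n (∣-difference x≡y) (∣-difference u≡v))
    where lemma : ∀ x y u v → (x + u) - (y + v) ≡ (x - y) + (u - v)
          lemma = solve-∀

  *-cong-mod : ∀ {x y u v} → x ≡ y [mod m ] → u ≡ v [mod m ] → x * u ≡ y * v [mod m ]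
  *-cong-mod {x} {y} {u} {v} x≡y u≡v = difference-∣ _ (lemma x y u v)
    (∣m∣n⇒∣m+n (∣n⇒∣m*n u (∣-difference x≡y)) (∣n⇒∣m*n y (∣-difference u≡v)))
    where lemma : ∀ x y u v → x * u - y * v ≡ u * (x - y) + y * (u - v)
          lemma = solve-∀

  *-congˡ-mod : ∀ {x y} z → x ≡ y [mod m ] → z * x ≡ z * y [mod m ]
  *-congˡ-mod z = *-cong-mod (≡[mod]-refl {z})

  *-congʳ-mod : ∀ {x y} z → x ≡ y [mod m ] → x * z ≡ y * z [mod m ]
  *-congʳ-mod z x≡y = *-cong-mod x≡y (≡[mod]-refl {z})

  neg-cong-mod : ∀ {x y} → x ≡ y [mod m ] → - x ≡ - y [mod m ]
  neg-cong-mod {x} {y} x≡y = difference-∣ _ (lemma x y) (∣m⇒∣-m (∣-difference x≡y))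
    where lemma : ∀ x y → - x - - y ≡ - (x - y)
          lemma = solve-∀

  -‿cong-mod : ∀ {x y u v} → x ≡ y [mod m ] → u ≡ v [mod m ] → x - u ≡ y - v [mod m ]
  -‿cong-mod x≡y u≡v = +-cong-mod x≡y (neg-cong-mod u≡v)

  multiple≡0 : ∀ q → q * m ≡ + 0 [mod m ]
  multiple≡0 q = mod-intro (divides q (ℤ.+-identityʳ (q * m)))

  ≡0⇒∣ : ∀ {x} → x ≡ + 0 [mod m ] → m ∣ x
  ≡0⇒∣ {x} (mod-intro (divides q eq)) = divides q (trans (sym (ℤ.+-identityʳ x)) eq)

  ≡[mod]-isEquivalence : IsEquivalence _≡_[mod m ]
  ≡[mod]-isEquivalence = record { refl = ≡[mod]-refl ; sym = ≡[mod]-sym ; trans = ≡[mod]-trans }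

≡[mod]-setoid : ℤ → Setoid _ _
≡[mod]-setoid m = record { isEquivalence = ≡[mod]-isEquivalence {m} }

module ≡[mod]-Reasoning (m : ℤ) = SetoidReasoning (≡[mod]-setoid m)

≡[mod]-weaken : ∀ {d m x y} → d ∣ m → x ≡ y [mod m ] → x ≡ y [mod d ]
≡[mod]-weaken d∣m x≡y = mod-intro (∣-trans d∣m (∣-difference x≡y))

*-scale-mod : ∀ {m x y} c → x ≡ y [mod m ] → x * c ≡ y * c [mod m * c ]
*-scale-mod {m} {x} {y} c x≡y = difference-∣ _ (lemma x y c) (*-monoˡ-∣ c (∣-difference x≡y))
  where lemma : ∀ x y c → x * c - y * c ≡ (x - y) * c
        lemma = solve-∀

*-cancelˡ-mod : ∀ c .{{_ : NonZero c}} {m x y} → c * x ≡ c * y [mod c * m ] → x ≡ y [mod m ]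
*-cancelˡ-mod c {m} {x} {y} (mod-intro (divides q eq)) =
  mod-intro (divides q (ℤ.*-cancelˡ-≡ c (x - y) (q * m) (trans (distrib c x y) (trans eq (swap q c m)))))
  where distrib : ∀ c x y → c * (x - y) ≡ c * x - c * y
        distrib = solve-∀
        swap : ∀ q c m → q * (c * m) ≡ c * (q * m)
        swap = solve-∀

-- Parity, residues and odd inverses modulo 128

residue : ∀ d .{{_ : ℕ.NonZero d}} x → x ≡ + (x %ℕ d) [mod + d ]
residue d x = difference-∣ _ (cong (_- + (x %ℕ d)) (a≡a%ℕn+[a/ℕn]*n x d))
  (divides (x /ℕ d) (lemma (+ (x %ℕ d)) (x /ℕ d) (+ d)))
  where lemma : ∀ r q d → r + q * d - r ≡ q * d
        lemma = solve-∀

residueFin : ∀ d .{{_ : ℕ.NonZero d}} x → Σ (Fin d) λ i → x ≡ + toℕ i [mod + d ]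
residueFin d x = fromℕ< (n%ℕd<d x d) ,
  subst (λ r → x ≡ + r [mod + d ]) (sym (Fin.toℕ-fromℕ< (n%ℕd<d x d))) (residue d x)

toℕ-injective-mod : ∀ {d} {i j : Fin d} → + toℕ i ≡ + toℕ j [mod + d ] → i ≡ j
toℕ-injective-mod {d} {i} {j} (mod-intro (divides q i-j≡qd)) = Fin.toℕ-injective (by-sign q i-j≡qd)
  where
  instance
    d≢0 : ℕ.NonZero d
    d≢0 = Fin.nonZeroIndex i
  residue-unique : ∀ {a b} k → a ℕ.< d → b ℕ.< d → + a ≡ + b + + k * + d → a ≡ b
  residue-unique {a} {b} k a<d b<d a≡b+kd = begin
    a                       ≡⟨ sym (m<n⇒m%n≡m a<d) ⟩
    a ℕ.% d                 ≡⟨ cong (ℕ._% d) (ℤ.+-injective a≡b+kd′) ⟩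
    (b ℕ.+ k ℕ.* d) ℕ.% d   ≡⟨ [m+kn]%n≡m%n b k d ⟩
    b ℕ.% d                 ≡⟨ m<n⇒m%n≡m b<d ⟩
    b                       ∎
    where
    open ≡-Reasoning
    a≡b+kd′ : + a ≡ + (b ℕ.+ k ℕ.* d)
    a≡b+kd′ = trans a≡b+kd (trans (cong (_+_ (+ b)) (sym (ℤ.pos-* k d))) (sym (ℤ.pos-+ b (k ℕ.* d))))
  move : ∀ x y {z} → x - y ≡ z → x ≡ y + z
  move x y refl = lemma x y
    where lemma : ∀ x y → x ≡ y + (x - y)
          lemma = solve-∀
  by-sign : ∀ q → + toℕ i - + toℕ j ≡ q * + d → toℕ i ≡ toℕ j
  by-sign (+ k)    eq = residue-unique k (Fin.toℕ<n i) (Fin.toℕ<n j) (move (+ toℕ i) (+ toℕ j) eq)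
  by-sign -[1+ k ] eq =
    sym (residue-unique (suc k) (Fin.toℕ<n j) (Fin.toℕ<n i) (move (+ toℕ j) (+ toℕ i) j-i≡[1+k]d))
    where
    j-i≡[1+k]d : + toℕ j - + toℕ i ≡ + suc k * + d
    j-i≡[1+k]d = trans (lemma (+ toℕ i) (+ toℕ j)) (trans (cong -_ eq) (ℤ.neg-distribˡ-* -[1+ k ] (+ d)))
      where lemma : ∀ x y → y - x ≡ - (x - y)
            lemma = solve-∀

parity : ∀ x → x ≡ + 0 [mod + 2 ] ⊎ x ≡ + 1 [mod + 2 ]
parity x with x %ℕ 2 | n%ℕd<d x 2 | residue 2 x
... | 0           | _            | x≡0 = inj₁ x≡0
... | 1           | _            | x≡1 = inj₂ x≡1
... | suc (suc _) | s≤s (s≤s ()) | _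

1≢0[mod2] : ¬ (+ 1 ≡ + 0 [mod + 2 ])
1≢0[mod2] (mod-intro (divides (+ zero)  ()))
1≢0[mod2] (mod-intro (divides (+ suc _) ()))
1≢0[mod2] (mod-intro (divides -[1+ _ ] ()))

odd⇒¬even : ∀ {x} → x ≡ + 1 [mod + 2 ] → ¬ (x ≡ + 0 [mod + 2 ])
odd⇒¬even x≡1 x≡0 = 1≢0[mod2] (≡[mod]-trans (≡[mod]-sym x≡1) x≡0)

2∣128 : + 2 ∣ + 128
2∣128 = divides (+ 64) refl

-- u · oddInverse u = 1 − e⁴ with e = 1 − u², and 4 ∣ e when u is odd.
oddInverse : ℤ → ℤ
oddInverse u = let e = + 1 - u * u in u * (+ 1 + e) * (+ 1 + e * e)

oddInverse-inverse : ∀ {u} → u ≡ + 1 [mod + 2 ] → u * oddInverse u ≡ + 1 [mod + 128 ]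
oddInverse-inverse {u} (mod-intro (divides t u-1≡2t)) =
  subst (λ u → u * oddInverse u ≡ + 1 [mod + 128 ]) (sym u≡1+2t)
        (mod-intro (divides (- (+ 2 * s⁴)) (identity t)))
  where
  u≡1+2t : u ≡ + 1 + t * + 2
  u≡1+2t = trans (lemma u) (cong (_+_ (+ 1)) u-1≡2t)
    where lemma : ∀ u → u ≡ + 1 + (u - + 1)
          lemma = solve-∀
  s⁴ : ℤ
  s⁴ = let s = t * (t + + 1) in s * s * s * s
  identity : ∀ t → let u = + 1 + t * + 2 ; e = + 1 - u * u ; s = t * (t + + 1)
                   in u * (u * (+ 1 + e) * (+ 1 + e * e)) - + 1 ≡ - (+ 2 * (s * s * s * s)) * + 128
  identity = solve-∀

odd-cancel : ∀ {x a b} → x ≡ + 1 [mod + 2 ] → a * x ≡ b * x [mod + 128 ] → a ≡ b [mod + 128 ]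
odd-cancel {x} {a} {b} x-odd ax≡bx = begin
  a                       ≡⟨ sym (ℤ.*-identityʳ a) ⟩
  a * + 1                 ≈⟨ *-congˡ-mod a (oddInverse-inverse x-odd) ⟨
  a * (x * oddInverse x)  ≡⟨ sym (ℤ.*-assoc a x (oddInverse x)) ⟩
  a * x * oddInverse x    ≈⟨ *-congʳ-mod (oddInverse x) ax≡bx ⟩
  b * x * oddInverse x    ≡⟨ ℤ.*-assoc b x (oddInverse x) ⟩
  b * (x * oddInverse x)  ≈⟨ *-congˡ-mod b (oddInverse-inverse x-odd) ⟩
  b * + 1                 ≡⟨ ℤ.*-identityʳ b ⟩
  b                       ∎
  where open ≡[mod]-Reasoning (+ 128)

divide-by-odd : ∀ d .{{_ : ℕ.NonZero d}} → + d ∣ + 128 → ∀ {x} → x ≡ + 1 [mod + 2 ] →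
                ∀ y → Σ (Fin d) λ i → y ≡ + toℕ i * x [mod + d ]
divide-by-odd d d∣128 {x} x-odd y = i , (begin
  y                       ≡⟨ sym (ℤ.*-identityʳ y) ⟩
  y * + 1                 ≈⟨ *-congˡ-mod y (≡[mod]-weaken d∣128 (oddInverse-inverse x-odd)) ⟨
  y * (x * oddInverse x)  ≡⟨ lemma y x (oddInverse x) ⟩
  y * oddInverse x * x    ≈⟨ *-congʳ-mod x y/x≡i ⟩
  + toℕ i * x             ∎)
  where
  open ≡[mod]-Reasoning (+ d)
  lemma : ∀ y x z → y * (x * z) ≡ y * z * x
  lemma = solve-∀
  i : Fin d
  i = proj₁ (residueFin d (y * oddInverse x))
  y/x≡i : y * oddInverse x ≡ + toℕ i [mod + d ]
  y/x≡i = proj₂ (residueFin d (y * oddInverse x))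

open Matrix₃ +-*-rawRing public

-- Polynomial identities between matrix entries are proved by the ring solver on matrices of
-- variables, evaluated at the entries; normalisation needs concrete indices, hence ∀-Fin3.
private
  open +-*-Solver using (Polynomial; _:+_; _:*_; :-_; con; var; prove; ⟦_⟧; ⟦_⟧↓)

  polynomialRawRing : ℕ → RawRing _ _
  polynomialRawRing n = record
    { Carrier = Polynomial n ; _≈_ = _≡_
    ; _+_ = _:+_ ; _*_ = _:*_ ; -_ = :-_ ; 0# = con (+ 0) ; 1# = con (+ 1) }

  module P₉ = Matrix₃ (polynomialRawRing 9)
  module P₁₈ = Matrix₃ (polynomialRawRing 18)

  entries : Matrix → Vec ℤ 9
  entries A = tabulate (λ k → uncurry A (remQuot 3 k))

  𝕏 : P₉.Matrix
  𝕏 i j = var (combine i j)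

  𝕏₁ 𝕏₂ : P₁₈.Matrix
  𝕏₁ i j = var (combine i j ↑ˡ 9)
  𝕏₂ i j = var (9 ↑ʳ combine i j)

  module ByNormalisation {n} (ρ : Vec ℤ n) (P Q : Matrix₃.Matrix (polynomialRawRing n)) where
    entry : ∀ i j → ⟦ P i j ⟧↓ ρ ≡ ⟦ Q i j ⟧↓ ρ → ⟦ P i j ⟧ ρ ≡ ⟦ Q i j ⟧ ρ
    entry i j = prove ρ (P i j) (Q i j)

det-· : ∀ A B → det (A · B) ≡ det A * det B
det-· A B = prove (entries A ++ entries B) (P₁₈.det (𝕏₁ P₁₈.· 𝕏₂)) (P₁₈.det 𝕏₁ :* P₁₈.det 𝕏₂) refl

adj-right : ∀ A i j → (A · adj A) i j ≡ (det A ⋆ 𝟙) i j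
adj-right A = ∀-Fin3 (∀-Fin3 (entry 0F 0F refl) (entry 0F 1F refl) (entry 0F 2F refl))
                     (∀-Fin3 (entry 1F 0F refl) (entry 1F 1F refl) (entry 1F 2F refl))
                     (∀-Fin3 (entry 2F 0F refl) (entry 2F 1F refl) (entry 2F 2F refl))
  where open ByNormalisation (entries A) (𝕏 P₉.· P₉.adj 𝕏) (P₉.det 𝕏 P₉.⋆ P₉.𝟙)

adj-left : ∀ A i j → (adj A · A) i j ≡ (det A ⋆ 𝟙) i j
adj-left A = ∀-Fin3 (∀-Fin3 (entry 0F 0F refl) (entry 0F 1F refl) (entry 0F 2F refl))
                    (∀-Fin3 (entry 1F 0F refl) (entry 1F 1F refl) (entry 1F 2F refl))
                    (∀-Fin3 (entry 2F 0F refl) (entry 2F 1F refl) (entry 2F 2F refl))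
  where open ByNormalisation (entries A) (P₉.adj 𝕏 P₉.· 𝕏) (P₉.det 𝕏 P₉.⋆ P₉.𝟙)

·-assoc : ∀ A B C i j → ((A · B) · C) i j ≡ (A · (B · C)) i j
·-assoc A B C i j = lemma (A i 0F) (A i 1F) (A i 2F)
                          (B 0F 0F) (B 0F 1F) (B 0F 2F) (B 1F 0F) (B 1F 1F) (B 1F 2F) (B 2F 0F) (B 2F 1F) (B 2F 2F)
                          (C 0F j) (C 1F j) (C 2F j)
  where
  lemma : ∀ a₀ a₁ a₂ b₀₀ b₀₁ b₀₂ b₁₀ b₁₁ b₁₂ b₂₀ b₂₁ b₂₂ c₀ c₁ c₂ →
            (a₀ * b₀₀ + a₁ * b₁₀ + a₂ * b₂₀) * c₀
          + (a₀ * b₀₁ + a₁ * b₁₁ + a₂ * b₂₁) * c₁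
          + (a₀ * b₀₂ + a₁ * b₁₂ + a₂ * b₂₂) * c₂
          ≡ a₀ * (b₀₀ * c₀ + b₀₁ * c₁ + b₀₂ * c₂)
          + a₁ * (b₁₀ * c₀ + b₁₁ * c₁ + b₁₂ * c₂)
          + a₂ * (b₂₀ * c₀ + b₂₁ * c₁ + b₂₂ * c₂)
  lemma = solve-∀

·-⋆ : ∀ A x B i j → (A · (x ⋆ B)) i j ≡ x * (A · B) i j
·-⋆ A x B i j = lemma x (A i 0F) (A i 1F) (A i 2F) (B 0F j) (B 1F j) (B 2F j)
  where lemma : ∀ x a₀ a₁ a₂ b₀ b₁ b₂ →
                a₀ * (x * b₀) + a₁ * (x * b₁) + a₂ * (x * b₂)
                ≡ x * (a₀ * b₀ + a₁ * b₁ + a₂ * b₂)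
        lemma = solve-∀

⋆-· : ∀ x A B i j → ((x ⋆ A) · B) i j ≡ x * (A · B) i j
⋆-· x A B i j = lemma x (A i 0F) (A i 1F) (A i 2F) (B 0F j) (B 1F j) (B 2F j)
  where lemma : ∀ x a₀ a₁ a₂ b₀ b₁ b₂ →
                x * a₀ * b₀ + x * a₁ * b₁ + x * a₂ * b₂
                ≡ x * (a₀ * b₀ + a₁ * b₁ + a₂ * b₂)
        lemma = solve-∀

infix 4 _≋_[mod_]
_≋_[mod_] : Matrix → Matrix → ℤ → Set
A ≋ B [mod m ] = ∀ i j → A i j ≡ B i j [mod m ]

module _ {m : ℤ} where

  ·-cong-mod : ∀ A A′ B B′ → A ≋ A′ [mod m ] → B ≋ B′ [mod m ] → A · B ≋ A′ · B′ [mod m ]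
  ·-cong-mod A A′ B B′ A≡A′ B≡B′ i j =
    +-cong-mod (+-cong-mod (*-cong-mod (A≡A′ i 0F) (B≡B′ 0F j)) (*-cong-mod (A≡A′ i 1F) (B≡B′ 1F j)))
               (*-cong-mod (A≡A′ i 2F) (B≡B′ 2F j))

  adj-cong-mod : ∀ A B → A ≋ B [mod m ] → adj A ≋ adj B [mod m ]
  adj-cong-mod A B A≡B i j = -‿cong-mod (*-cong-mod (A≡B _ _) (A≡B _ _)) (*-cong-mod (A≡B _ _) (A≡B _ _))

  det-cong-mod : ∀ A B → A ≋ B [mod m ] → det A ≡ det B [mod m ]
  det-cong-mod A B A≡B = +-cong-mod (+-cong-mod (term 0F) (term 1F)) (term 2F)
    where term : ∀ k → A 0F k * adj A k 0F ≡ B 0F k * adj B k 0F [mod m ]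
          term k = *-cong-mod (A≡B 0F k) (adj-cong-mod A B A≡B k 0F)

  det≡0-of-row≡0 : ∀ H r → (∀ c → H r c ≡ + 0 [mod m ]) → det H ≡ + 0 [mod m ]
  det≡0-of-row≡0 H r row≡0 = begin
    det H              ≡⟨ sym (ℤ.*-identityʳ (det H)) ⟩
    det H * + 1        ≡⟨ cong (det H *_) (sym (𝟙-diagonal r)) ⟩
    det H * 𝟙 r r      ≡⟨ sym (adj-right H r r) ⟩
    (H · adj H) r r    ≈⟨ +-cong-mod (+-cong-mod (*-congʳ-mod (adj H 0F r) (row≡0 0F))
                                                 (*-congʳ-mod (adj H 1F r) (row≡0 1F)))
                                     (*-congʳ-mod (adj H 2F r) (row≡0 2F)) ⟩
    + 0                ∎
    where
    open ≡[mod]-Reasoning m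
    𝟙-diagonal : ∀ r → 𝟙 r r ≡ + 1
    𝟙-diagonal = ∀-Fin3 refl refl refl

  det≡0-of-columns₀₂≡0-below-row₀ : ∀ H → H 1F 0F ≡ + 0 [mod m ] → H 2F 0F ≡ + 0 [mod m ] →
                                    H 1F 2F ≡ + 0 [mod m ] → H 2F 2F ≡ + 0 [mod m ] → det H ≡ + 0 [mod m ]
  det≡0-of-columns₀₂≡0-below-row₀ H h₁₀ h₂₀ h₁₂ h₂₂ = begin
    det H                 ≡⟨ sym (ℤ.*-identityʳ (det H)) ⟩
    det H * + 1           ≡⟨ sym (adj-left H 0F 0F) ⟩
    (adj H · H) 0F 0F     ≈⟨ +-cong-mod (+-cong-mod (*-congʳ-mod (H 0F 0F) adj₀₀≡0) (*-congˡ-mod (adj H 0F 1F) h₁₀))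
                                        (*-congˡ-mod (adj H 0F 2F) h₂₀) ⟩
    + 0 * H 0F 0F + adj H 0F 1F * + 0 + adj H 0F 2F * + 0
                          ≡⟨ lemma (H 0F 0F) (adj H 0F 1F) (adj H 0F 2F) ⟩
    + 0                   ∎
    where
    open ≡[mod]-Reasoning m
    lemma : ∀ x y z → + 0 * x + y * + 0 + z * + 0 ≡ + 0
    lemma = solve-∀
    adj₀₀≡0 : adj H 0F 0F ≡ + 0 [mod m ]
    adj₀₀≡0 = ≡[mod]-trans (-‿cong-mod (*-congˡ-mod (H 1F 1F) h₂₂) (*-congʳ-mod (H 2F 1F) h₁₂))
                           (≡⇒≡[mod] (lemma′ (H 1F 1F)))
      where lemma′ : ∀ x → x * + 0 - + 0 ≡ + 0
            lemma′ = solve-∀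

-- ℤ₂ level by level

private
  ∣ℤ⇒≡[mod] : ∀ {m x y} → m ∣ℤ (x - y) → x ≡ y [mod m ]
  ∣ℤ⇒≡[mod] (q , eq) = mod-intro (divides q eq)

  ≡[mod]⇒∣ℤ : ∀ {m x y} → x ≡ y [mod m ] → m ∣ℤ (x - y)
  ≡[mod]⇒∣ℤ (mod-intro (divides q eq)) = q , eq

-- The arguments are explicit: _≈₂_ unfolds to a Π-type, from which they cannot be inferred.
≈₂⇒≡[mod] : ∀ x y → x ≈₂ y → ∀ n → seq x n ≡ seq y n [mod pow2 n ]
≈₂⇒≡[mod] x y x≈y n = ∣ℤ⇒≡[mod] (x≈y n)

≡[mod]⇒≈₂ : ∀ x y → (∀ n → seq x n ≡ seq y n [mod pow2 n ]) → x ≈₂ y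
≡[mod]⇒≈₂ x y x≡y n = ≡[mod]⇒∣ℤ (x≡y n)

level : ℕ → Mat → Matrix
level n A i j = seq (A i j) n

≈M⇒≋[mod] : ∀ A B → A ≈M B → ∀ n → level n A ≋ level n B [mod pow2 n ]
≈M⇒≋[mod] A B A≈B n i j = ∣ℤ⇒≡[mod] (A≈B i j n)

≋[mod]⇒≈M : ∀ A B → (∀ n → level n A ≋ level n B [mod pow2 n ]) → A ≈M B
≋[mod]⇒≈M A B A≡B i j n = ≡[mod]⇒∣ℤ (A≡B n i j)

pow2-+ : ∀ k n → pow2 (k ℕ.+ n) ≡ pow2 k * pow2 n
pow2-+ k n = trans (cong +_ (ℕ.^-distribˡ-+-* 2 k n)) (ℤ.pos-* (2 ℕ.^ k) (2 ℕ.^ n))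

pow2-nonZero : ∀ k → NonZero (pow2 k)
pow2-nonZero k = ℕ.m^n≢0 2 k

seq-coherent : ∀ x k n → seq x (k ℕ.+ n) ≡ seq x n [mod pow2 n ]
seq-coherent x zero    n = ≡[mod]-refl
seq-coherent x (suc k) n = ≡[mod]-trans (≡[mod]-weaken (divides (pow2 k) (pow2-+ k n)) step) (seq-coherent x k n)
  where
  step : seq x (suc k ℕ.+ n) ≡ seq x (k ℕ.+ n) [mod pow2 (k ℕ.+ n) ]
  step = ∣ℤ⇒≡[mod] (coh x (k ℕ.+ n))

divide : ∀ k (x : ℤ₂) → seq x k ≡ + 0 [mod pow2 k ] → ι (pow2 k) ∣₂ x
divide k x xₖ≡0 = mkℤ₂ q q-coherent , ≡[mod]⇒≈₂ x (mkℤ₂ q q-coherent *₂ ι (pow2 k)) x≡q·2ᵏ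
  where
  divisible : ∀ n → pow2 k ∣ seq x (n ℕ.+ k)
  divisible n = ≡0⇒∣ (≡[mod]-trans (seq-coherent x n k) xₖ≡0)
  q : ℕ → ℤ
  q n = _∣_.quotient (divisible n)
  xₙ₊ₖ≡q·2ᵏ : ∀ n → seq x (n ℕ.+ k) ≡ q n * pow2 k
  xₙ₊ₖ≡q·2ᵏ n = _∣_.equality (divisible n)
  q-coherent : ∀ n → pow2 n ∣ℤ (q (suc n) - q n)
  q-coherent n = c , ℤ.*-cancelʳ-≡ (q (suc n) - q n) (c * pow2 n) (pow2 k) {{pow2-nonZero k}} (begin
    (q (suc n) - q n) * pow2 k               ≡⟨ distrib (q (suc n)) (q n) (pow2 k) ⟩
    q (suc n) * pow2 k - q n * pow2 k        ≡⟨ cong₂ _-_ (xₙ₊ₖ≡q·2ᵏ (suc n)) (xₙ₊ₖ≡q·2ᵏ n) ⟨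
    seq x (suc n ℕ.+ k) - seq x (n ℕ.+ k)    ≡⟨ proj₂ (coh x (n ℕ.+ k)) ⟩
    c * pow2 (n ℕ.+ k)                       ≡⟨ cong (c *_) (pow2-+ n k) ⟩
    c * (pow2 n * pow2 k)                    ≡⟨ sym (ℤ.*-assoc c (pow2 n) (pow2 k)) ⟩
    c * pow2 n * pow2 k                      ∎)
    where
    open ≡-Reasoning
    c : ℤ
    c = proj₁ (coh x (n ℕ.+ k))
    distrib : ∀ a b p → (a - b) * p ≡ a * p - b * p
    distrib = solve-∀
  x≡q·2ᵏ : ∀ n → seq x n ≡ q n * pow2 k [mod pow2 n ]
  x≡q·2ᵏ n = begin
    seq x n           ≈⟨ ≡[mod]-sym (seq-coherent x k n) ⟩
    seq x (k ℕ.+ n)   ≡⟨ cong (seq x) (ℕ.+-comm k n) ⟩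
    seq x (n ℕ.+ k)   ≡⟨ xₙ₊ₖ≡q·2ᵏ n ⟩
    q n * pow2 k      ∎
    where open ≡[mod]-Reasoning (pow2 n)

∣₂⇒≡0 : ∀ k x → ι (pow2 k) ∣₂ x → seq x k ≡ + 0 [mod pow2 k ]
∣₂⇒≡0 k x (q , x≈q·2ᵏ) =
  ≡[mod]-trans (≈₂⇒≡[mod] x (q *₂ ι (pow2 k)) x≈q·2ᵏ k) (multiple≡0 (seq q k))

ι-pow2-cancel : ∀ k x y → ι (pow2 k) *₂ x ≈₂ ι (pow2 k) *₂ y → x ≈₂ y
ι-pow2-cancel k x y 2ᵏx≈2ᵏy = ≡[mod]⇒≈₂ x y levelwise
  where
  levelwise : ∀ n → seq x n ≡ seq y n [mod pow2 n ]
  levelwise n = begin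
    seq x n           ≈⟨ ≡[mod]-sym (seq-coherent x k n) ⟩
    seq x (k ℕ.+ n)   ≈⟨ *-cancelˡ-mod (pow2 k) {{pow2-nonZero k}} 2ᵏx≡2ᵏy ⟩
    seq y (k ℕ.+ n)   ≈⟨ seq-coherent y k n ⟩
    seq y n           ∎
    where
    open ≡[mod]-Reasoning (pow2 n)
    2ᵏx≡2ᵏy : pow2 k * seq x (k ℕ.+ n) ≡ pow2 k * seq y (k ℕ.+ n) [mod pow2 k * pow2 n ]
    2ᵏx≡2ᵏy = subst (λ m → pow2 k * seq x (k ℕ.+ n) ≡ pow2 k * seq y (k ℕ.+ n) [mod m ]) (pow2-+ k n)
                (≈₂⇒≡[mod] (ι (pow2 k) *₂ x) (ι (pow2 k) *₂ y) 2ᵏx≈2ᵏy (k ℕ.+ n))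

ℤ₂-rawRing : RawRing _ _
ℤ₂-rawRing = record
  { Carrier = ℤ₂ ; _≈_ = _≈₂_ ; _+_ = _+₂_ ; _*_ = _*₂_ ; -_ = -₂_ ; 0# = ι (+ 0) ; 1# = ι (+ 1) }

open Matrix₃ ℤ₂-rawRing using () renaming (det to det₂; adj to adj₂; _⋆_ to _⋆₂_)

≈M-refl : ∀ {A} → A ≈M A
≈M-refl {A} = ≋[mod]⇒≈M A A λ n i j → ≡[mod]-refl

≈M-sym : ∀ {A B} → A ≈M B → B ≈M A
≈M-sym {A} {B} A≈B = ≋[mod]⇒≈M B A λ n i j → ≡[mod]-sym (≈M⇒≋[mod] A B A≈B n i j)

≈M-trans : ∀ {A B C} → A ≈M B → B ≈M C → A ≈M C
≈M-trans {A} {B} {C} A≈B B≈C = ≋[mod]⇒≈M A C λ n i j →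
  ≡[mod]-trans (≈M⇒≋[mod] A B A≈B n i j) (≈M⇒≋[mod] B C B≈C n i j)

≈M-setoid : Setoid _ _
≈M-setoid = record
  { Carrier = Mat ; _≈_ = _≈M_
  ; isEquivalence = record { refl = λ {A} → ≈M-refl {A} ; sym = λ {A} {B} → ≈M-sym {A} {B}
                           ; trans = λ {A} {B} {C} → ≈M-trans {A} {B} {C} } }

module ≈M-Reasoning = SetoidReasoning ≈M-setoid

·M-congʳ : ∀ A A′ B → A ≈M A′ → A ·M B ≈M A′ ·M B
·M-congʳ A A′ B A≈A′ = ≋[mod]⇒≈M (A ·M B) (A′ ·M B) λ n →
  ·-cong-mod (level n A) (level n A′) (level n B) (level n B)
             (≈M⇒≋[mod] A A′ A≈A′ n) (λ i j → ≡[mod]-refl)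

·M-assoc : ∀ A B C → (A ·M B) ·M C ≈M A ·M (B ·M C)
·M-assoc A B C = ≋[mod]⇒≈M ((A ·M B) ·M C) (A ·M (B ·M C)) λ n i j →
  ≡⇒≡[mod] (·-assoc (level n A) (level n B) (level n C) i j)

Invertible : ℤ₂ → Set
Invertible x = Σ ℤ₂ λ y → x *₂ y ≈₂ ι (+ 1)

IsGL₃⇒det-invertible : ∀ A → IsGL₃ A → Invertible (det₂ A)
IsGL₃⇒det-invertible A (B , AB≈I , _) = det₂ B , ≡[mod]⇒≈₂ (det₂ A *₂ det₂ B) (ι (+ 1)) levelwise
  where
  levelwise : ∀ n → det (level n A) * det (level n B) ≡ + 1 [mod pow2 n ]
  levelwise n = begin
    det (level n A) * det (level n B)   ≡⟨ det-· (level n A) (level n B) ⟨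
    det (level n (A ·M B))              ≈⟨ det-cong-mod (level n (A ·M B)) (level n I₃)
                                                        (≈M⇒≋[mod] (A ·M B) I₃ AB≈I n) ⟩
    + 1                                 ∎
    where open ≡[mod]-Reasoning (pow2 n)

det-invertible⇒IsGL₃ : ∀ A → Invertible (det₂ A) → IsGL₃ A
det-invertible⇒IsGL₃ A (c , det·c≈1) = c ⋆₂ adj₂ A ,
  ≋[mod]⇒≈M (A ·M (c ⋆₂ adj₂ A)) I₃ right , ≋[mod]⇒≈M ((c ⋆₂ adj₂ A) ·M A) I₃ left
  where
  level-I₃ : ∀ n i j → 𝟙 i j ≡ level n I₃ i j
  level-I₃ n = ∀-Fin3 (∀-Fin3 refl refl refl) (∀-Fin3 refl refl refl) (∀-Fin3 refl refl refl)
  scaled-identity : ∀ n i j → seq c n * (det (level n A) * 𝟙 i j) ≡ level n I₃ i j [mod pow2 n ]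
  scaled-identity n i j = begin
    seq c n * (det (level n A) * 𝟙 i j)   ≡⟨ lemma (seq c n) (det (level n A)) (𝟙 i j) ⟩
    det (level n A) * seq c n * 𝟙 i j     ≈⟨ *-congʳ-mod (𝟙 i j) (≈₂⇒≡[mod] (det₂ A *₂ c) (ι (+ 1)) det·c≈1 n) ⟩
    + 1 * 𝟙 i j                           ≡⟨ ℤ.*-identityˡ (𝟙 i j) ⟩
    𝟙 i j                                 ≡⟨ level-I₃ n i j ⟩
    level n I₃ i j                        ∎
    where open ≡[mod]-Reasoning (pow2 n)
          lemma : ∀ c d e → c * (d * e) ≡ d * c * e
          lemma = solve-∀
  right : ∀ n → level n A · (seq c n ⋆ adj (level n A)) ≋ level n I₃ [mod pow2 n ]
  right n i j = ≡[mod]-trans (≡⇒≡[mod] (trans (·-⋆ (level n A) (seq c n) (adj (level n A)) i j)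
                                              (cong (seq c n *_) (adj-right (level n A) i j))))
                             (scaled-identity n i j)
  left : ∀ n → (seq c n ⋆ adj (level n A)) · level n A ≋ level n I₃ [mod pow2 n ]
  left n i j = ≡[mod]-trans (≡⇒≡[mod] (trans (⋆-· (seq c n) (adj (level n A)) (level n A) i j)
                                             (cong (seq c n *_) (adj-left (level n A) i j))))
                            (scaled-identity n i j)

IsGL₃-·M : ∀ A B → IsGL₃ A → IsGL₃ B → IsGL₃ (A ·M B)
IsGL₃-·M A B A-inv B-inv = product (IsGL₃⇒det-invertible A A-inv) (IsGL₃⇒det-invertible B B-inv)
  where
  product : Invertible (det₂ A) → Invertible (det₂ B) → IsGL₃ (A ·M B)
  product (cA , detA·cA≈1) (cB , detB·cB≈1) =
    det-invertible⇒IsGL₃ (A ·M B) (cA *₂ cB , ≡[mod]⇒≈₂ (det₂ (A ·M B) *₂ (cA *₂ cB)) (ι (+ 1)) levelwise)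
    where
    dA dB : ℕ → ℤ
    dA n = det (level n A)
    dB n = det (level n B)
    levelwise : ∀ n → det (level n (A ·M B)) * (seq cA n * seq cB n) ≡ + 1 [mod pow2 n ]
    levelwise n = begin
      det (level n (A ·M B)) * (seq cA n * seq cB n)  ≡⟨ cong (_* (seq cA n * seq cB n)) (det-· (level n A) (level n B)) ⟩
      dA n * dB n * (seq cA n * seq cB n)             ≡⟨ lemma (dA n) (dB n) (seq cA n) (seq cB n) ⟩
      (dA n * seq cA n) * (dB n * seq cB n)           ≈⟨ *-cong-mod (≈₂⇒≡[mod] (det₂ A *₂ cA) (ι (+ 1)) detA·cA≈1 n)
                                                                    (≈₂⇒≡[mod] (det₂ B *₂ cB) (ι (+ 1)) detB·cB≈1 n) ⟩
      + 1                                             ∎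
      where open ≡[mod]-Reasoning (pow2 n)
            lemma : ∀ a b c d → a * b * (c * d) ≡ (a * c) * (b * d)
            lemma = solve-∀

IsGL₃-right-factor : ∀ A R M ε → ε * ε ≡ + 1 → (∀ n → det (level n R) ≡ ε * + 128) →
                     R ·M M ≈M A ·M γ → Invertible (det₂ A) → IsGL₃ M
IsGL₃-right-factor A R M ε ε²≡1 det-R RM≈Aγ (c , detA·c≈1) =
  det-invertible⇒IsGL₃ M (ι ε *₂ c , ≡[mod]⇒≈₂ (det₂ M *₂ (ι ε *₂ c)) (ι (+ 1)) levelwise)
  where
  128εdetM≡128detA : ∀ n → + 128 * (ε * det (level n M)) ≡ + 128 * det (level n A) [mod pow2 n ]
  128εdetM≡128detA n = begin
    + 128 * (ε * det (level n M))       ≡⟨ lemma ε (det (level n M)) ⟩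
    ε * + 128 * det (level n M)         ≡⟨ cong (_* det (level n M)) (det-R n) ⟨
    det (level n R) * det (level n M)   ≡⟨ det-· (level n R) (level n M) ⟨
    det (level n (R ·M M))              ≈⟨ det-cong-mod (level n (R ·M M)) (level n (A ·M γ))
                                                        (≈M⇒≋[mod] (R ·M M) (A ·M γ) RM≈Aγ n) ⟩
    det (level n (A ·M γ))              ≡⟨ det-· (level n A) (level n γ) ⟩
    det (level n A) * + 128             ≡⟨ ℤ.*-comm (det (level n A)) (+ 128) ⟩
    + 128 * det (level n A)             ∎
    where open ≡[mod]-Reasoning (pow2 n)
          lemma : ∀ ε d → + 128 * (ε * d) ≡ ε * + 128 * d
          lemma = solve-∀
  εdetM≈detA : ι ε *₂ det₂ M ≈₂ det₂ A
  εdetM≈detA = ι-pow2-cancel 7 (ι ε *₂ det₂ M) (det₂ A)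
    (≡[mod]⇒≈₂ (ι (pow2 7) *₂ (ι ε *₂ det₂ M)) (ι (pow2 7) *₂ det₂ A) 128εdetM≡128detA)
  levelwise : ∀ n → det (level n M) * (ε * seq c n) ≡ + 1 [mod pow2 n ]
  levelwise n = begin
    det (level n M) * (ε * seq c n)     ≡⟨ lemma (det (level n M)) ε (seq c n) ⟩
    ε * det (level n M) * seq c n       ≈⟨ *-congʳ-mod (seq c n) (≈₂⇒≡[mod] (ι ε *₂ det₂ M) (det₂ A) εdetM≈detA n) ⟩
    det (level n A) * seq c n           ≈⟨ ≈₂⇒≡[mod] (det₂ A *₂ c) (ι (+ 1)) detA·c≈1 n ⟩
    + 1                                 ∎
    where open ≡[mod]-Reasoning (pow2 n)
          lemma : ∀ d ε c → d * (ε * c) ≡ ε * d * c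
          lemma = solve-∀

IsGL₃⇒det≢0[mod2] : ∀ A → IsGL₃ A → ¬ (det (level 7 A) ≡ + 0 [mod + 2 ])
IsGL₃⇒det≢0[mod2] A A-inv = odd (IsGL₃⇒det-invertible A A-inv)
  where
  odd : Invertible (det₂ A) → ¬ (det (level 7 A) ≡ + 0 [mod + 2 ])
  odd (c , detA·c≈1) det≡0 = 1≢0[mod2] (begin
    + 1                          ≈⟨ ≡[mod]-weaken 2∣128 (≈₂⇒≡[mod] (det₂ A *₂ c) (ι (+ 1)) detA·c≈1 7) ⟨
    det (level 7 A) * seq c 7    ≈⟨ *-congʳ-mod (seq c 7) det≡0 ⟩
    + 0                          ∎)
    where open ≡[mod]-Reasoning (+ 2)

LowerLeft≡0 : ℤ → Matrix → Set
LowerLeft≡0 m H = H 1F 0F ≡ + 0 [mod m ] × H 2F 0F ≡ + 0 [mod m ]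

InK⇒LowerLeft≡0 : ∀ A → InK A → LowerLeft≡0 (+ 128) (level 7 A)
InK⇒LowerLeft≡0 A (_ , a₁₀ , a₂₀) = ∣₂⇒≡0 7 (A 1F 0F) a₁₀ , ∣₂⇒≡0 7 (A 2F 0F) a₂₀

InK-intro : ∀ A → IsGL₃ A → LowerLeft≡0 (+ 128) (level 7 A) → InK A
InK-intro A A-inv (a₁₀≡0 , a₂₀≡0) = A-inv , divide 7 (A 1F 0F) a₁₀≡0 , divide 7 (A 2F 0F) a₂₀≡0

LowerLeft≡0-· : ∀ {m} A B → LowerLeft≡0 m A → LowerLeft≡0 m B → LowerLeft≡0 m (A · B)
LowerLeft≡0-· {m} A B (a₁₀ , a₂₀) (b₁₀ , b₂₀) = entry a₁₀ , entry a₂₀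
  where
  entry : ∀ {r} → A r 0F ≡ + 0 [mod m ] → (A · B) r 0F ≡ + 0 [mod m ]
  entry {r} aᵣ₀ = ≡[mod]-trans
    (+-cong-mod (+-cong-mod (*-congʳ-mod (B 0F 0F) aᵣ₀) (*-congˡ-mod (A r 1F) b₁₀))
                (*-congˡ-mod (A r 2F) b₂₀))
    (≡⇒≡[mod] (lemma (A r 1F) (A r 2F)))
    where lemma : ∀ a₁ a₂ → + 0 + a₁ * + 0 + a₂ * + 0 ≡ + 0
          lemma = solve-∀

InK-·M : ∀ A B → InK A → InK B → InK (A ·M B)
InK-·M A B A∈K B∈K = InK-intro (A ·M B) (IsGL₃-·M A B (proj₁ A∈K) (proj₁ B∈K))
  (LowerLeft≡0-· (level 7 A) (level 7 B) (InK⇒LowerLeft≡0 A A∈K) (InK⇒LowerLeft≡0 B B∈K))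

InK⇒row₂-odd : ∀ k → InK k → Σ (Fin 3) λ c → level 7 k 2F c ≡ + 1 [mod + 2 ]
InK⇒row₂-odd k k∈K with parity (level 7 k 2F 1F) | parity (level 7 k 2F 2F)
... | _             | inj₂ k₂₂-odd  = 2F , k₂₂-odd
... | inj₂ k₂₁-odd  | inj₁ _        = 1F , k₂₁-odd
... | inj₁ k₂₁-even | inj₁ k₂₂-even = ⊥-elim (IsGL₃⇒det≢0[mod2] k (proj₁ k∈K) (det≡0-of-row≡0 (level 7 k) 2F
  (∀-Fin3 (≡[mod]-weaken 2∣128 (proj₂ (InK⇒LowerLeft≡0 k k∈K))) k₂₁-even k₂₂-even)))

InK⇒column₂-odd : ∀ A → InK A → level 7 A 2F 2F ≡ + 0 [mod + 2 ] → level 7 A 1F 2F ≡ + 1 [mod + 2 ]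
InK⇒column₂-odd A A∈K a₂₂-even with parity (level 7 A 1F 2F)
... | inj₂ a₁₂-odd  = a₁₂-odd
... | inj₁ a₁₂-even = ⊥-elim (IsGL₃⇒det≢0[mod2] A (proj₁ A∈K) (det≡0-of-columns₀₂≡0-below-row₀ (level 7 A)
  (≡[mod]-weaken 2∣128 (proj₁ (InK⇒LowerLeft≡0 A A∈K))) (≡[mod]-weaken 2∣128 (proj₂ (InK⇒LowerLeft≡0 A A∈K)))
  a₁₂-even a₂₂-even))

κ : Idx → Mat
κ (inj₁ i) = fromRows ((+ 1 ∷ + 0 ∷ + 0 ∷ []) ∷ (+ 0 ∷ + 1 ∷ + toℕ i ∷ [])
                     ∷ (+ 0 ∷ + 0 ∷ + 1 ∷ []) ∷ [])
κ (inj₂ i) = fromRows ((+ 1 ∷ + 0 ∷ + 0 ∷ []) ∷ (+ 0 ∷ + 0 ∷ + 1 ∷ [])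
                     ∷ (+ 0 ∷ + 1 ∷ + (2 ℕ.* toℕ i) ∷ []) ∷ [])

ε : Idx → ℤ
ε (inj₁ _) = + 1
ε (inj₂ _) = -[1+ 0 ]

ε²≡1 : ∀ j → ε j * ε j ≡ + 1
ε²≡1 (inj₁ _) = refl
ε²≡1 (inj₂ _) = refl

det-κ : ∀ j n → det (level n (κ j)) ≡ ε j
det-κ (inj₁ i) n rewrite ℤ.*-zeroʳ (+ toℕ i) = refl
det-κ (inj₂ i) n = refl

det-rep : ∀ j n → det (level n (rep j)) ≡ ε j * + 128
det-rep (inj₁ i) n rewrite ℤ.*-zeroʳ (+ toℕ i) = refl
det-rep (inj₂ i) n = refl

γ-column : Fin 3 → (Fin 3 → ℤ) → ℤ
γ-column 0F v = -[1+ 127 ] * v 1F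
γ-column 1F v = v 0F
γ-column 2F v = v 2F

·γ : ∀ n H r c → (H · level n γ) r c ≡ γ-column c (H r)
·γ n H r 0F = lemma (H r 0F) (H r 1F) (H r 2F)
  where lemma : ∀ x y z → x * + 0 + y * -[1+ 127 ] + z * + 0 ≡ -[1+ 127 ] * y
        lemma = solve-∀
·γ n H r 1F = lemma (H r 0F) (H r 1F) (H r 2F)
  where lemma : ∀ x y z → x * + 1 + y * + 0 + z * + 0 ≡ x
        lemma = solve-∀
·γ n H r 2F = lemma (H r 0F) (H r 1F) (H r 2F)
  where lemma : ∀ x y z → x * + 0 + y * + 0 + z * + 1 ≡ z
        lemma = solve-∀

rep≈κ·γ : ∀ j → rep j ≈M κ j ·M γ
rep≈κ·γ j = ≋[mod]⇒≈M (rep j) (κ j ·M γ) λ n r c →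
  ≡⇒≡[mod] (trans (by-computation j n r c) (sym (·γ n (level n (κ j)) r c)))
  where
  by-computation : ∀ j n r c → level n (rep j) r c ≡ γ-column c (level n (κ j) r)
  by-computation (inj₁ _) n = ∀-Fin3 (∀-Fin3 refl refl refl) (∀-Fin3 refl refl refl) (∀-Fin3 refl refl refl)
  by-computation (inj₂ _) n = ∀-Fin3 (∀-Fin3 refl refl refl) (∀-Fin3 refl refl refl) (∀-Fin3 refl refl refl)

κ∈K : ∀ j → InK (κ j)
κ∈K j = InK-intro (κ j) (det-invertible⇒IsGL₃ (κ j) (ι (ε j) , detκ·ε≈1)) (lower-left j)
  where
  detκ·ε≈1 : det₂ (κ j) *₂ ι (ε j) ≈₂ ι (+ 1)
  detκ·ε≈1 = ≡[mod]⇒≈₂ (det₂ (κ j) *₂ ι (ε j)) (ι (+ 1)) λ n →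
    ≡⇒≡[mod] (trans (cong (_* ε j) (det-κ j n)) (ε²≡1 j))
  lower-left : ∀ j → LowerLeft≡0 (+ 128) (level 7 (κ j))
  lower-left (inj₁ _) = ≡[mod]-refl , ≡[mod]-refl
  lower-left (inj₂ _) = ≡[mod]-refl , ≡[mod]-refl

coset⊆KγK : ∀ j g → InCoset (rep j) g → InKγK g
coset⊆KγK j g (k , k∈K , g≈rep·k) = κ j , k , κ∈K j , k∈K , (begin
  g               ≈⟨ g≈rep·k ⟩
  rep j ·M k      ≈⟨ ·M-congʳ (rep j) (κ j ·M γ) k (rep≈κ·γ j) ⟩
  κ j ·M γ ·M k   ∎)
  where open ≈M-Reasoning

slope : Idx → ℤ
slope (inj₁ i) = + toℕ i
slope (inj₂ i) = + (2 ℕ.* toℕ i)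

sheared unsheared : Idx → Fin 3
sheared   (inj₁ _) = 1F
sheared   (inj₂ _) = 2F
unsheared (inj₁ _) = 2F
unsheared (inj₂ _) = 1F

∀-row : ∀ j {ℓ} {P : Fin 3 → Set ℓ} → P 0F → P (sheared j) → P (unsheared j) → ∀ r → P r
∀-row (inj₁ _) p₀ pₛ pᵤ = ∀-Fin3 p₀ pₛ pᵤ
∀-row (inj₂ _) p₀ pₛ pᵤ = ∀-Fin3 p₀ pᵤ pₛ

private
  e₁-row : ∀ x y z → + 0 * x + + 1 * y + + 0 * z ≡ y
  e₁-row = solve-∀

  e₂-row : ∀ x y z → + 0 * x + + 0 * y + + 1 * z ≡ z
  e₂-row = solve-∀

  shear-row : ∀ t x y z → -[1+ 127 ] * x + + 0 * y + t * z ≡ t * z - + 128 * x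
  shear-row = solve-∀

rep-·-row₀ : ∀ j n H c → (level n (rep j) · H) 0F c ≡ H 1F c
rep-·-row₀ (inj₁ _) n H c = e₁-row (H 0F c) (H 1F c) (H 2F c)
rep-·-row₀ (inj₂ _) n H c = e₁-row (H 0F c) (H 1F c) (H 2F c)

rep-·-sheared : ∀ j n H c → (level n (rep j) · H) (sheared j) c ≡ slope j * H 2F c - + 128 * H 0F c
rep-·-sheared j@(inj₁ _) n H c = shear-row (slope j) (H 0F c) (H 1F c) (H 2F c)
rep-·-sheared j@(inj₂ _) n H c = shear-row (slope j) (H 0F c) (H 1F c) (H 2F c)

rep-·-unsheared : ∀ j n H c → (level n (rep j) · H) (unsheared j) c ≡ H 2F c
rep-·-unsheared (inj₁ _) n H c = e₂-row (H 0F c) (H 1F c) (H 2F c)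
rep-·-unsheared (inj₂ _) n H c = e₂-row (H 0F c) (H 1F c) (H 2F c)

Slope : Idx → Matrix → Fin 3 → Set
Slope j H c = H (sheared j) c ≡ slope j * H (unsheared j) c [mod + 128 ]

-- Disjointness of the cosets

coset⇒slope : ∀ j g k → g ≈M rep j ·M k →
              (∀ c → Slope j (level 7 g) c) × (∀ c → level 7 g (unsheared j) c ≡ level 7 k 2F c [mod + 128 ])
coset⇒slope j g k g≈rep·k = slope-relation , unsheared-row
  where
  G K′ : Matrix
  G = level 7 g
  K′ = level 7 k
  G≡rep·K′ : G ≋ level 7 (rep j) · K′ [mod + 128 ]
  G≡rep·K′ = ≈M⇒≋[mod] g (rep j ·M k) g≈rep·k 7
  unsheared-row : ∀ c → G (unsheared j) c ≡ K′ 2F c [mod + 128 ]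
  unsheared-row c = ≡[mod]-trans (G≡rep·K′ (unsheared j) c) (≡⇒≡[mod] (rep-·-unsheared j 7 K′ c))
  slope-relation : ∀ c → Slope j G c
  slope-relation c = begin
    G (sheared j) c                         ≈⟨ G≡rep·K′ (sheared j) c ⟩
    (level 7 (rep j) · K′) (sheared j) c    ≡⟨ rep-·-sheared j 7 K′ c ⟩
    slope j * K′ 2F c - + 128 * K′ 0F c     ≈⟨ drop-multiple (slope j * K′ 2F c) (K′ 0F c) ⟩
    slope j * K′ 2F c                       ≈⟨ *-congˡ-mod (slope j) (unsheared-row c) ⟨
    slope j * G (unsheared j) c             ∎
    where
    open ≡[mod]-Reasoning (+ 128)
    drop-multiple : ∀ x y → x - + 128 * y ≡ x [mod + 128 ]
    drop-multiple x y = mod-intro (divides (- y) (lemma x y))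
      where lemma : ∀ x y → x - + 128 * y - x ≡ - y * + 128
            lemma = solve-∀

coset⇒odd-column : ∀ j g k → InK k → g ≈M rep j ·M k →
                   Σ (Fin 3) λ c → level 7 g (unsheared j) c ≡ + 1 [mod + 2 ]
coset⇒odd-column j g k k∈K g≈rep·k with InK⇒row₂-odd k k∈K
... | c , k₂c-odd = c , ≡[mod]-trans (≡[mod]-weaken 2∣128 (proj₂ (coset⇒slope j g k g≈rep·k) c)) k₂c-odd

private
  halve : ∀ {a b} → + (2 ℕ.* a) ≡ + (2 ℕ.* b) [mod + 128 ] → + a ≡ + b [mod + 64 ]
  halve {a} {b} 2a≡2b =
    *-cancelˡ-mod (+ 2) (subst₂ (λ x y → x ≡ y [mod + 128 ]) (ℤ.pos-* 2 a) (ℤ.pos-* 2 b) 2a≡2b)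

  even-slope⇒even : ∀ a {x y} → y ≡ + (2 ℕ.* a) * x [mod + 128 ] → y ≡ + 0 [mod + 2 ]
  even-slope⇒even a {x} y≡2ax = ≡[mod]-trans (≡[mod]-weaken 2∣128 y≡2ax)
    (≡[mod]-trans (≡⇒≡[mod] (trans (cong (_* x) (ℤ.pos-* 2 a)) (lemma (+ a) x))) (multiple≡0 (+ a * x)))
    where lemma : ∀ a x → + 2 * a * x ≡ a * x * + 2
          lemma = solve-∀

cosets-disjoint : ∀ j j′ g → InCoset (rep j) g → InCoset (rep j′) g → j ≡ j′
cosets-disjoint j j′ g (k , k∈K , g≈rep·k) (k′ , k′∈K , g≈rep′·k′) =
  compare j j′ (coset⇒odd-column j g k k∈K g≈rep·k) (coset⇒odd-column j′ g k′ k′∈K g≈rep′·k′)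
               (proj₁ (coset⇒slope j g k g≈rep·k)) (proj₁ (coset⇒slope j′ g k′ g≈rep′·k′))
  where
  G : Matrix
  G = level 7 g
  OddColumn : Idx → Set
  OddColumn j = Σ (Fin 3) λ c → G (unsheared j) c ≡ + 1 [mod + 2 ]
  compare : ∀ j j′ → OddColumn j → OddColumn j′ → (∀ c → Slope j G c) → (∀ c → Slope j′ G c) → j ≡ j′
  compare (inj₁ _) (inj₁ _) (c , odd) _ slope slope′ =
    cong inj₁ (toℕ-injective-mod (odd-cancel odd (≡[mod]-trans (≡[mod]-sym (slope c)) (slope′ c))))
  compare (inj₂ _) (inj₂ _) (c , odd) _ slope slope′ =
    cong inj₂ (toℕ-injective-mod (halve (odd-cancel odd (≡[mod]-trans (≡[mod]-sym (slope c)) (slope′ c)))))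
  compare (inj₁ _) (inj₂ i′) (c , odd) _ _ slope′ =
    ⊥-elim (odd⇒¬even odd (even-slope⇒even (toℕ i′) (slope′ c)))
  compare (inj₂ i) (inj₁ _) _ (c , odd) slope _ =
    ⊥-elim (odd⇒¬even odd (even-slope⇒even (toℕ i) (slope c)))

-- K γ K is covered by the cosets

slope-of-K : ∀ A → InK A → Σ Idx λ j → Slope j (level 7 A) 2F
slope-of-K A A∈K with parity (level 7 A 2F 2F)
... | inj₂ a₂₂-odd = inj₁ (proj₁ a₁₂/a₂₂) , proj₂ a₁₂/a₂₂
  where
  a₁₂/a₂₂ : Σ (Fin 128) λ i → level 7 A 1F 2F ≡ + toℕ i * level 7 A 2F 2F [mod + 128 ]
  a₁₂/a₂₂ = divide-by-odd 128 (divides (+ 1) refl) a₂₂-odd (level 7 A 1F 2F)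
... | inj₁ a₂₂-even@(mod-intro (divides s a₂₂≡2s)) = inj₂ i , (begin
  level 7 A 2F 2F                        ≡⟨ trans (sym (ℤ.+-identityʳ (level 7 A 2F 2F))) a₂₂≡2s ⟩
  s * + 2                                ≈⟨ *-scale-mod (+ 2) (proj₂ s/a₁₂) ⟩
  + toℕ i * level 7 A 1F 2F * + 2        ≡⟨ lemma (toℕ i) (level 7 A 1F 2F) ⟩
  + (2 ℕ.* toℕ i) * level 7 A 1F 2F      ∎)
  where
  open ≡[mod]-Reasoning (+ 128)
  s/a₁₂ : Σ (Fin 64) λ i → s ≡ + toℕ i * level 7 A 1F 2F [mod + 64 ]
  s/a₁₂ = divide-by-odd 64 (divides (+ 2) refl) (InK⇒column₂-odd A A∈K a₂₂-even) s
  i : Fin 64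
  i = proj₁ s/a₁₂
  lemma : ∀ i a → + i * a * + 2 ≡ + (2 ℕ.* i) * a
  lemma i a = trans (swap (+ i) a) (cong (_* a) (sym (ℤ.pos-* 2 i)))
    where swap : ∀ i a → i * a * + 2 ≡ + 2 * i * a
          swap = solve-∀

Aγ-column₀≡0 : ∀ A r → level 7 (A ·M γ) r 0F ≡ + 0 [mod + 128 ]
Aγ-column₀≡0 A r = ≡[mod]-trans (≡⇒≡[mod] (trans (·γ 7 (level 7 A) r 0F) (lemma (level 7 A r 1F))))
                                (multiple≡0 (- level 7 A r 1F))
  where lemma : ∀ y → -[1+ 127 ] * y ≡ - y * + 128
        lemma = solve-∀

Aγ-slope : ∀ j A → InK A → Slope j (level 7 A) 2F → ∀ c → Slope j (level 7 (A ·M γ)) c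
Aγ-slope j A A∈K a-slope = ∀-Fin3
  (both≡0 (Aγ-column₀≡0 A (sheared j)) (Aγ-column₀≡0 A (unsheared j)))
  (both≡0 (column₁ (sheared j) (proj₁ (lower-rows j (InK⇒LowerLeft≡0 A A∈K))))
          (column₁ (unsheared j) (proj₂ (lower-rows j (InK⇒LowerLeft≡0 A A∈K)))))
  column₂
  where
  Aγ : Matrix
  Aγ = level 7 (A ·M γ)
  both≡0 : ∀ {x y} → x ≡ + 0 [mod + 128 ] → y ≡ + 0 [mod + 128 ] → x ≡ slope j * y [mod + 128 ]
  both≡0 x≡0 y≡0 = ≡[mod]-trans x≡0
    (≡[mod]-sym (≡[mod]-trans (*-congˡ-mod (slope j) y≡0) (≡⇒≡[mod] (ℤ.*-zeroʳ (slope j)))))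
  lower-rows : ∀ j → LowerLeft≡0 (+ 128) (level 7 A) →
               level 7 A (sheared j) 0F ≡ + 0 [mod + 128 ] × level 7 A (unsheared j) 0F ≡ + 0 [mod + 128 ]
  lower-rows (inj₁ _) (a₁₀ , a₂₀) = a₁₀ , a₂₀
  lower-rows (inj₂ _) (a₁₀ , a₂₀) = a₂₀ , a₁₀
  column₁ : ∀ r → level 7 A r 0F ≡ + 0 [mod + 128 ] → Aγ r 1F ≡ + 0 [mod + 128 ]
  column₁ r aᵣ₀≡0 = ≡[mod]-trans (≡⇒≡[mod] (·γ 7 (level 7 A) r 1F)) aᵣ₀≡0
  column₂ : Slope j Aγ 2F
  column₂ rewrite ·γ 7 (level 7 A) (sheared j) 2F | ·γ 7 (level 7 A) (unsheared j) 2F = a-slope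

Aγ∈rep·K : ∀ j A → InK A → (∀ c → Slope j (level 7 (A ·M γ)) c) →
           Σ Mat λ m → InK m × (rep j ·M m ≈M A ·M γ)
Aγ∈rep·K j A A∈K h-slope = m , m∈K , rep·m≈h
  where
  h : Mat
  h = A ·M γ
  defect : Fin 3 → ℤ₂
  defect c = ι (slope j) *₂ h (unsheared j) c +₂ -₂ h (sheared j) c
  defect≡0 : ∀ c → seq (defect c) 7 ≡ + 0 [mod pow2 7 ]
  defect≡0 c = ≡[mod]-trans (-‿cong-mod (≡[mod]-refl {x = slope j * seq (h (unsheared j) c) 7}) (h-slope c))
                            (≡⇒≡[mod] (ℤ.+-inverseʳ (slope j * seq (h (unsheared j) c) 7)))
  quotient : Fin 3 → ℤ₂
  quotient c = proj₁ (divide 7 (defect c) (defect≡0 c))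
  m : Mat
  m 0F = quotient
  m 1F = h 0F
  m 2F = h (unsheared j)
  rep·m≈h : rep j ·M m ≈M h
  rep·m≈h = ≋[mod]⇒≈M (rep j ·M m) h λ n → ∀-row j (row₀ n) (sheared-row n) (unsheared-row n)
    where
    R·M : ℕ → Matrix
    R·M n = level n (rep j) · level n m
    row₀ : ∀ n c → R·M n 0F c ≡ level n h 0F c [mod pow2 n ]
    row₀ n c = ≡⇒≡[mod] (rep-·-row₀ j n (level n m) c)
    unsheared-row : ∀ n c → R·M n (unsheared j) c ≡ level n h (unsheared j) c [mod pow2 n ]
    unsheared-row n c = ≡⇒≡[mod] (rep-·-unsheared j n (level n m) c)
    sheared-row : ∀ n c → R·M n (sheared j) c ≡ level n h (sheared j) c [mod pow2 n ]
    sheared-row n c = begin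
      R·M n (sheared j) c     ≡⟨ rep-·-sheared j n (level n m) c ⟩
      t * u - + 128 * q       ≡⟨ lemma t u q ⟩
      t * u - q * + 128       ≈⟨ -‿cong-mod (≡[mod]-refl {x = t * u}) t·u-s≡q·128 ⟨
      t * u - (t * u - s)     ≡⟨ lemma′ (t * u) s ⟩
      s                       ∎
      where
      open ≡[mod]-Reasoning (pow2 n)
      t u s q : ℤ
      t = slope j
      u = seq (h (unsheared j) c) n
      s = seq (h (sheared j) c) n
      q = seq (quotient c) n
      t·u-s≡q·128 : t * u - s ≡ q * + 128 [mod pow2 n ]
      t·u-s≡q·128 = ≈₂⇒≡[mod] (defect c) (quotient c *₂ ι (pow2 7)) (proj₂ (divide 7 (defect c) (defect≡0 c))) n
      lemma : ∀ t u q → t * u - + 128 * q ≡ t * u - q * + 128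
      lemma = solve-∀
      lemma′ : ∀ x s → x - (x - s) ≡ s
      lemma′ = solve-∀
  m∈K : InK m
  m∈K = InK-intro m (IsGL₃-right-factor A (rep j) m (ε j) (ε²≡1 j) (det-rep j) rep·m≈h
                                        (IsGL₃⇒det-invertible A (proj₁ A∈K)))
                    (Aγ-column₀≡0 A 0F , Aγ-column₀≡0 A (unsheared j))

KγK⊆cosets : ∀ g → InKγK g → Σ Idx λ j → InCoset (rep j) g
KγK⊆cosets g (A , B , A∈K , B∈K , g≈AγB) = coset (slope-of-K A A∈K)
  where
  coset : Σ Idx (λ j → Slope j (level 7 A) 2F) → Σ Idx λ j → InCoset (rep j) g
  coset (j , a-slope) = j , m ·M B , InK-·M m B m∈K B∈K , (begin
    g                    ≈⟨ g≈AγB ⟩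
    A ·M γ ·M B          ≈⟨ ·M-congʳ (rep j ·M m) (A ·M γ) B rep·m≈Aγ ⟨
    rep j ·M m ·M B      ≈⟨ ·M-assoc (rep j) m B ⟩
    rep j ·M (m ·M B)    ∎)
    where
    open ≈M-Reasoning
    factorisation : Σ Mat λ m → InK m × (rep j ·M m ≈M A ·M γ)
    factorisation = Aγ∈rep·K j A A∈K (Aγ-slope j A A∈K a-slope)
    m : Mat
    m = proj₁ factorisation
    m∈K : InK m
    m∈K = proj₁ (proj₂ factorisation)
    rep·m≈Aγ : rep j ·M m ≈M A ·M γ
    rep·m≈Aγ = proj₂ (proj₂ factorisation)

lemma4p4 : ((g : Mat) → InKγK g → Σ Idx λ j → InCoset (rep j) g)
           × ((j : Idx) (g : Mat) → InCoset (rep j) g → InKγK g)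
           × ((j j′ : Idx) (g : Mat) → InCoset (rep j) g → InCoset (rep j′) g → j ≡ j′)
lemma4p4 = KγK⊆cosets , coset⊆KγK , cosets-disjoint
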